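{- Let $n\ge 2$, $e\ne f\in[n]$, and $\pi=(e\,f)$. Let $M$ and $M'$ be matroids on ground set $[n]$ of the same rank $r$, both having $\pi$ as an automorphism. If $M\setminus\{e,f\}=M'\setminus\{e,f\}$ and $M/\{e,f\}=M'/\{e,f\}$, then $M=M'$. That is, a rank-$r$ matroid on $[n]$ with automorphism $\pi$ is uniquely determined by $M\setminus\{e,f\}$ and $M/\{e,f\}$.
   Context: An automorphism of a matroid $M$ on $[n]$ is a permutation $\sigma$ of $[n]$ such that $X$ is a basis iff $\sigma(X)$ is a basis, for all $X\subseteq[n]$. $M\setminus\{e,f\}$ and $M/\{e,f\}$ denote deletion and contraction of $\{e,f\}$. -}

module Defs where

open import Data.Nat using (ℕ)
open import Data.Bool using (Bool; T)
open import Data.Fin using (Fin)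
open import Data.Fin.Subset using (Subset; _∈_; _∉_; _⊆_; _∪_; _-_; _─_; ⁅_⁆; ∣_∣; ∁)
open import Data.Fin.Permutation using (Permutation′; _⟨$⟩ˡ_)
open import Data.Vec using (tabulate; lookup)
open import Data.Product using (Σ; ∃; _×_)
open import Relation.Binary.PropositionalEquality using (_≡_)

record Matroid (n : ℕ) : Set where
  field
    isBasis  : Subset n → Bool
    nonempty : ∃ λ B → T (isBasis B)
    exchange : ∀ B₁ B₂ → T (isBasis B₁) → T (isBasis B₂) →
               ∀ x → x ∈ B₁ → x ∉ B₂ →
               ∃ λ y → y ∈ B₂ × y ∉ B₁ × T (isBasis ((B₁ - x) ∪ ⁅ y ⁆))

open Matroid public

module _ {n : ℕ} where

  Basis : Matroid n → Subset n → Set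
  Basis M B = T (isBasis M B)

  HasRank : Matroid n → ℕ → Set
  HasRank M r = ∀ B → Basis M B → ∣ B ∣ ≡ r

  Indep : Matroid n → Subset n → Set
  Indep M X = ∃ λ B → Basis M B × X ⊆ B

  MaxIndepIn : Matroid n → Subset n → Subset n → Set
  MaxIndepIn M S X = X ⊆ S × Indep M X × (∀ Y → X ⊆ Y → Y ⊆ S → Indep M Y → Y ⊆ X)

  -- bases of the deletion M \ T (ground set [n] ∖ T)
  DelBasis : Matroid n → Subset n → Subset n → Set
  DelBasis M T X = MaxIndepIn M (∁ T) X

  -- bases of the contraction M / T (ground set [n] ∖ T):
  -- X ⊆ [n] ∖ T with X ∪ I a basis of M for a basis I of M|T
  ConBasis : Matroid n → Subset n → Subset n → Set
  ConBasis M T X = X ⊆ ∁ T × (∃ λ I → MaxIndepIn M T I × Basis M (X ∪ I))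

  image : Permutation′ n → Subset n → Subset n
  image σ X = tabulate (λ i → lookup X (σ ⟨$⟩ˡ i))

  IsAutomorphism : Matroid n → Permutation′ n → Set
  IsAutomorphism M σ = ∀ X → isBasis M X ≡ isBasis M (image σ X)

-- Compare a basis B of M with M′ according to how it meets S = {e, f}.  If B avoids S it
-- is a basis of M \ S, and if it contains S then B ∖ S is a basis of M / S; in both cases
-- the shared minor returns a basis of M′ inside or around B, which equals B by counting.
-- If B = X ∪ {e} with X disjoint from S, the automorphism (e f) of M′ reduces the claim to
-- finding some t ∈ S with X ∪ {t} a basis of M′.  Such a t comes from the contraction when
-- S is dependent in M, from the deletion when X is maximal independent in [n] ∖ S, and
-- otherwise from a basis exchange in M′ between a basis X ∪ {g} avoiding S and a basis
-- containing S, both of which M and M′ share by the first two cases.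

module Submission where

open import Defs
open import Data.Nat using (ℕ; zero; suc; _≤_; _<_; _≥_)
open import Data.Nat.Properties using (<⇒≱; ≤-trans; ≤-refl; ≤-reflexive; ≤-pred; <-≤-trans)
open import Data.Bool using (true; false; T)
open import Data.Bool.Properties using (T?)
open import Data.Fin using (Fin; zero; suc; _≟_)
open import Data.Fin.Subset
  using (Subset; inside; outside; _∈_; _∉_; _⊆_; _∪_; _─_; _-_; ⁅_⁆; ∣_∣; ∁)
open import Data.Fin.Subset.Properties
open import Data.Fin.Permutation using (Permutation′; transpose; _⟨$⟩ˡ_)
open import Data.Vec using (_∷_; here; there)
open import Data.Vec.Properties using (lookup∘tabulate; []=⇒lookup; lookup⇒[]=)
open import Data.Product using (∃; _×_; _,_; proj₁; proj₂)
open import Data.Sum using (_⊎_; inj₁; inj₂; [_,_]′)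
open import Data.Empty using (⊥-elim)
open import Function using (_∘_)
open import Function.Bundles using (_⇔_; Equivalence)
open import Relation.Nullary using (¬_; yes; no; contradiction)
open import Relation.Nullary.Decidable using (_×-dec_; dec-true; dec-false)
open import Relation.Binary.PropositionalEquality
  using (_≡_; _≢_; refl; sym; trans; cong; subst)

private
  variable
    n : ℕ
    x : Fin n
    p q s : Subset n

x∈p─q⇒x∉q : ∀ (p q : Subset n) → x ∈ p ─ q → x ∉ q
x∈p─q⇒x∉q (_ ∷ p) (inside  ∷ q) (there x∈) (there x∈q) = x∈p─q⇒x∉q p q x∈ x∈q
x∈p─q⇒x∉q (_ ∷ p) (outside ∷ q) (there x∈) (there x∈q) = x∈p─q⇒x∉q p q x∈ x∈q
x∈p─q⇒x∉q (inside ∷ p) (outside ∷ q) here ()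

∣p∣≡1+∣p-x∣ : ∀ (p : Subset n) → x ∈ p → ∣ p ∣ ≡ suc ∣ p - x ∣
∣p∣≡1+∣p-x∣ {x = zero}  (inside ∷ p) here = cong suc (cong ∣_∣ (sym (p─⊥≡p p)))
∣p∣≡1+∣p-x∣ {x = suc x} (inside  ∷ p) (there x∈p) = cong suc (∣p∣≡1+∣p-x∣ p x∈p)
∣p∣≡1+∣p-x∣ {x = suc x} (outside ∷ p) (there x∈p) = ∣p∣≡1+∣p-x∣ p x∈p

p⊆q∧∣q∣≤∣p∣⇒q⊆p : p ⊆ q → ∣ q ∣ ≤ ∣ p ∣ → q ⊆ p
p⊆q∧∣q∣≤∣p∣⇒q⊆p {p = p} p⊆q ∣q∣≤∣p∣ {x} x∈q with x ∈? p
... | yes x∈p = x∈p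
... | no  x∉p = contradiction ∣q∣≤∣p∣ (<⇒≱ (p⊂q⇒∣p∣<∣q∣ (p⊆q , x , x∈q , x∉p)))

p⊆q∧∣q∣≤∣p∣⇒p≡q : p ⊆ q → ∣ q ∣ ≤ ∣ p ∣ → p ≡ q
p⊆q∧∣q∣≤∣p∣⇒p≡q p⊆q ∣q∣≤∣p∣ = ⊆-antisym p⊆q (p⊆q∧∣q∣≤∣p∣⇒q⊆p p⊆q ∣q∣≤∣p∣)

x∉p⇒∣p∣<∣p∪⁅x⁆∣ : x ∉ p → ∣ p ∣ < ∣ p ∪ ⁅ x ⁆ ∣
x∉p⇒∣p∣<∣p∪⁅x⁆∣ {x = x} {p = p} x∉p =
  p⊂q⇒∣p∣<∣q∣ (p⊆p∪q ⁅ x ⁆ , x , q⊆p∪q p ⁅ x ⁆ (x∈⁅x⁆ x) , x∉p)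

p⊈q⇒∃ : ∀ (p q : Subset n) → ¬ p ⊆ q → ∃ λ x → x ∈ p × x ∉ q
p⊈q⇒∃ p q p⊈q with nonempty? (p ─ q)
... | yes (x , x∈p─q) = x , p─q⊆p p q x∈p─q , x∈p─q⇒x∉q p q x∈p─q
... | no  p─q-empty = ⊥-elim (p⊈q p⊆q)
  where
  p⊆q : p ⊆ q
  p⊆q {x} x∈p with x ∈? q
  ... | yes x∈q = x∈q
  ... | no  x∉q = contradiction (x , x∈p∧x∉q⇒x∈p─q x∈p x∉q) p─q-empty

∪-lub : p ⊆ s → q ⊆ s → p ∪ q ⊆ s
∪-lub {p = p} {q = q} p⊆s q⊆s x∈ with x∈p∪q⁻ p q x∈
... | inj₁ x∈p = p⊆s x∈p
... | inj₂ x∈q = q⊆s x∈q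

x∈p⇒⁅x⁆⊆p : x ∈ p → ⁅ x ⁆ ⊆ p
x∈p⇒⁅x⁆⊆p {x = x} x∈p y∈⁅x⁆ = subst (_∈ _) (sym (x∈⁅y⁆⇒x≡y x y∈⁅x⁆)) x∈p

x∈p∪⁅y⁆⁻ : ∀ (p : Subset n) y → x ∈ p ∪ ⁅ y ⁆ → x ∈ p ⊎ x ≡ y
x∈p∪⁅y⁆⁻ p y x∈ with x∈p∪q⁻ p ⁅ y ⁆ x∈
... | inj₁ x∈p = inj₁ x∈p
... | inj₂ x∈⁅y⁆ = inj₂ (x∈⁅y⁆⇒x≡y y x∈⁅y⁆)

q⊆p⇒p─q∪q≡p : q ⊆ p → (p ─ q) ∪ q ≡ p
q⊆p⇒p─q∪q≡p {q = q} {p = p} q⊆p = ⊆-antisym (∪-lub (p─q⊆p p q) q⊆p) p⊆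
  where
  p⊆ : p ⊆ (p ─ q) ∪ q
  p⊆ {x} x∈p with x ∈? q
  ... | yes x∈q = q⊆p∪q (p ─ q) q x∈q
  ... | no  x∉q = p⊆p∪q q (x∈p∧x∉q⇒x∈p─q x∈p x∉q)

T⇔T⇒≡ : ∀ a b → (T a → T b) → (T b → T a) → a ≡ b
T⇔T⇒≡ true  true  _ _ = refl
T⇔T⇒≡ false false _ _ = refl
T⇔T⇒≡ true  false a⇒b _ = ⊥-elim (a⇒b _)
T⇔T⇒≡ false true  _ b⇒a = ⊥-elim (b⇒a _)

∈-image⁺ : ∀ (σ : Permutation′ n) W → σ ⟨$⟩ˡ x ∈ W → x ∈ image σ W
∈-image⁺ {x = x} σ W σx∈W = lookup⇒[]= x _ (trans (lookup∘tabulate _ x) ([]=⇒lookup σx∈W))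

∈-image⁻ : ∀ (σ : Permutation′ n) W → x ∈ image σ W → σ ⟨$⟩ˡ x ∈ W
∈-image⁻ {x = x} σ W x∈σW =
  lookup⇒[]= (σ ⟨$⟩ˡ x) W (trans (sym (lookup∘tabulate _ x)) ([]=⇒lookup x∈σW))

module _ {e f : Fin n} where

  transposeˡ-f : transpose e f ⟨$⟩ˡ f ≡ e
  transposeˡ-f rewrite dec-true (f ≟ f) refl = refl

  transposeˡ-e : e ≢ f → transpose e f ⟨$⟩ˡ e ≡ f
  transposeˡ-e e≢f rewrite dec-false (e ≟ f) e≢f | dec-true (e ≟ e) refl = refl

  transposeˡ-other : x ≢ e → x ≢ f → transpose e f ⟨$⟩ˡ x ≡ x
  transposeˡ-other {x = x} x≢e x≢f rewrite dec-false (x ≟ f) x≢f | dec-false (x ≟ e) x≢e = refl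

  image-transpose : e ≢ f → e ∉ p → f ∉ p → image (transpose e f) (p ∪ ⁅ f ⁆) ≡ p ∪ ⁅ e ⁆
  image-transpose {p = p} e≢f e∉p f∉p = ⊆-antisym image⊆ ⊆image
    where
    e∉p∪⁅f⁆ : e ∉ p ∪ ⁅ f ⁆
    e∉p∪⁅f⁆ e∈ = [ e∉p , e≢f ]′ (x∈p∪⁅y⁆⁻ p f e∈)
    image⊆ : image (transpose e f) (p ∪ ⁅ f ⁆) ⊆ p ∪ ⁅ e ⁆
    image⊆ {x} x∈ with x ≟ e | x ≟ f
    ... | yes x≡e | _ = subst (_∈ p ∪ ⁅ e ⁆) (sym x≡e) (q⊆p∪q p ⁅ e ⁆ (x∈⁅x⁆ e))
    ... | no _ | yes x≡f = ⊥-elim (e∉p∪⁅f⁆ (subst (_∈ p ∪ ⁅ f ⁆)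
            (trans (cong (transpose e f ⟨$⟩ˡ_) x≡f) transposeˡ-f) (∈-image⁻ (transpose e f) _ x∈)))
    ... | no x≢e | no x≢f = [ p⊆p∪q ⁅ e ⁆ , (λ x≡f → contradiction x≡f x≢f) ]′
            (x∈p∪⁅y⁆⁻ p f (subst (_∈ p ∪ ⁅ f ⁆) (transposeˡ-other x≢e x≢f) (∈-image⁻ (transpose e f) _ x∈)))
    ⊆image : p ∪ ⁅ e ⁆ ⊆ image (transpose e f) (p ∪ ⁅ f ⁆)
    ⊆image {x} x∈ with x∈p∪⁅y⁆⁻ p e x∈
    ... | inj₂ refl = ∈-image⁺ (transpose e f) (p ∪ ⁅ f ⁆)
                        (subst (_∈ p ∪ ⁅ f ⁆) (sym (transposeˡ-e e≢f)) (q⊆p∪q p ⁅ f ⁆ (x∈⁅x⁆ f)))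
    ... | inj₁ x∈p = ∈-image⁺ (transpose e f) (p ∪ ⁅ f ⁆)
                        (subst (_∈ p ∪ ⁅ f ⁆) (sym (transposeˡ-other x≢e x≢f)) (p⊆p∪q ⁅ f ⁆ x∈p))
      where
      x≢e : x ≢ e
      x≢e refl = e∉p x∈p
      x≢f : x ≢ f
      x≢f refl = f∉p x∈p

module RankLemmas (N : Matroid n) {r : ℕ} (rank : HasRank N r) where

  ⊆Basis∧r≤∣X∣⇒Basis : ∀ {X C} → Basis N C → X ⊆ C → r ≤ ∣ X ∣ → Basis N X
  ⊆Basis∧r≤∣X∣⇒Basis C-basis X⊆C r≤∣X∣ =
    subst (Basis N) (sym (p⊆q∧∣q∣≤∣p∣⇒p≡q X⊆C (≤-trans (≤-reflexive (rank _ C-basis)) r≤∣X∣))) C-basis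

  Basis⊈small : ∀ {X C} → Basis N C → ∣ X ∣ < r → ∃ λ x → x ∈ C × x ∉ X
  Basis⊈small {X} {C} C-basis ∣X∣<r = p⊈q⇒∃ C X λ C⊆X →
    <⇒≱ ∣X∣<r (≤-trans (≤-reflexive (sym (rank C C-basis))) (p⊆q⇒∣p∣≤∣q∣ C⊆X))

  module _ {X C : Subset n} {x : Fin n} (C-basis : Basis N C) (X⊆C : X ⊆ C) (x∈C : x ∈ C)
           (x∉X : x ∉ X) (1+∣X∣≡r : suc ∣ X ∣ ≡ r) where

    X∪⁅x⁆⊆C : X ∪ ⁅ x ⁆ ⊆ C
    X∪⁅x⁆⊆C = ∪-lub X⊆C (x∈p⇒⁅x⁆⊆p x∈C)

    r≤∣X∪⁅x⁆∣ : r ≤ ∣ X ∪ ⁅ x ⁆ ∣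
    r≤∣X∪⁅x⁆∣ = ≤-trans (≤-reflexive (sym 1+∣X∣≡r)) (x∉p⇒∣p∣<∣p∪⁅x⁆∣ x∉X)

    X∪⁅x⁆-Basis : Basis N (X ∪ ⁅ x ⁆)
    X∪⁅x⁆-Basis = ⊆Basis∧r≤∣X∣⇒Basis C-basis X∪⁅x⁆⊆C r≤∣X∪⁅x⁆∣

    Basis⊆ : ∀ {U} → X ⊆ U → x ∈ U → C ⊆ U
    Basis⊆ X⊆U x∈U = ⊆-trans
      (p⊆q∧∣q∣≤∣p∣⇒q⊆p X∪⁅x⁆⊆C (≤-trans (≤-reflexive (rank C C-basis)) r≤∣X∪⁅x⁆∣))
      (∪-lub X⊆U (x∈p⇒⁅x⁆⊆p x∈U))

-- Exchanging the elements of D outside A ∪ I one at a time keeps I inside D.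
Indep⇒Basis-within : (N : Matroid n) → ∀ {I A} → Indep N I → Basis N A →
                     ∃ λ D → Basis N D × I ⊆ D × D ⊆ A ∪ I
Indep⇒Basis-within N {I} {A} (D , D-basis , I⊆D) A-basis = go _ D D-basis I⊆D ≤-refl
  where
  go : ∀ k D → Basis N D → I ⊆ D → ∣ D ─ (A ∪ I) ∣ < k → ∃ λ D → Basis N D × I ⊆ D × D ⊆ A ∪ I
  go (suc k) D D-basis I⊆D excess<k with D ⊆? (A ∪ I)
  ... | yes D⊆A∪I = D , D-basis , I⊆D , D⊆A∪I
  ... | no D⊈A∪I with p⊈q⇒∃ D (A ∪ I) D⊈A∪I
  ...   | x , x∈D , x∉A∪I with exchange N D A D-basis A-basis x x∈D (x∉A∪I ∘ p⊆p∪q I)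
  ...     | y , y∈A , _ , D′-basis = go k D′ D′-basis I⊆D′ (<-≤-trans excess′<excess (≤-pred excess<k))
    where
    D′ = (D - x) ∪ ⁅ y ⁆
    I⊆D′ : I ⊆ D′
    I⊆D′ z∈I = p⊆p∪q ⁅ y ⁆ (x∈p∧x≢y⇒x∈p-y (I⊆D z∈I) λ { refl → x∉A∪I (q⊆p∪q A I z∈I) })
    excess-of-D′ : ∀ {z} → z ∈ D′ → z ∉ A ∪ I → z ∈ D ─ (A ∪ I) × z ≢ x
    excess-of-D′ z∈D′ z∉A∪I with x∈p∪⁅y⁆⁻ (D - x) y z∈D′
    ... | inj₁ z∈D-x = x∈p∧x∉q⇒x∈p─q (p─q⊆p D ⁅ x ⁆ z∈D-x) z∉A∪I , x∉⁅y⁆⇒x≢y (x∈p─q⇒x∉q D ⁅ x ⁆ z∈D-x)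
    ... | inj₂ refl = ⊥-elim (z∉A∪I (p⊆p∪q I y∈A))
    excess′<excess : ∣ D′ ─ (A ∪ I) ∣ < ∣ D ─ (A ∪ I) ∣
    excess′<excess = p⊂q⇒∣p∣<∣q∣
      ( (λ z∈ → proj₁ (excess-of-D′ (p─q⊆p D′ (A ∪ I) z∈) (x∈p─q⇒x∉q D′ (A ∪ I) z∈)))
      , x , x∈p∧x∉q⇒x∈p─q x∈D x∉A∪I
      , λ x∈ → proj₂ (excess-of-D′ (p─q⊆p D′ (A ∪ I) x∈) x∉A∪I) refl )

module Minors (M M′ : Matroid n) {r : ℕ} (rank : HasRank M r) (rank′ : HasRank M′ r)
              (T : Subset n) where

  Basis⊆∁T⇒DelBasis : ∀ {B} → Basis M B → B ⊆ ∁ T → DelBasis M T B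
  Basis⊆∁T⇒DelBasis {B} B-basis B⊆∁T = B⊆∁T , (B , B-basis , ⊆-refl) , maximal
    where
    maximal : ∀ Y → B ⊆ Y → Y ⊆ ∁ T → Indep M Y → Y ⊆ B
    maximal Y B⊆Y _ (C , C-basis , Y⊆C) = ⊆-trans Y⊆C (p⊆q∧∣q∣≤∣p∣⇒q⊆p (⊆-trans B⊆Y Y⊆C)
      (≤-reflexive (trans (rank C C-basis) (sym (rank B B-basis)))))

  T⊆Basis⇒ConBasis : ∀ {B} → Basis M B → T ⊆ B → ConBasis M T (B ─ T)
  T⊆Basis⇒ConBasis {B} B-basis T⊆B =
    (λ x∈ → x∉p⇒x∈∁p (x∈p─q⇒x∉q B T x∈)) ,
    T , (⊆-refl , (B , B-basis , T⊆B) , (λ _ _ Y⊆T _ → Y⊆T)) ,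
    subst (Basis M) (sym (q⊆p⇒p─q∪q≡p T⊆B)) B-basis

  deletion-determines-disjoint-Basis : (∀ X → DelBasis M T X → DelBasis M′ T X) →
                                       ∀ {B} → Basis M B → B ⊆ ∁ T → Basis M′ B
  deletion-determines-disjoint-Basis del {B} B-basis B⊆∁T
    with del B (Basis⊆∁T⇒DelBasis B-basis B⊆∁T)
  ... | _ , (C′ , C′-basis , B⊆C′) , _ = RankLemmas.⊆Basis∧r≤∣X∣⇒Basis M′ rank′
          C′-basis B⊆C′ (≤-reflexive (sym (rank B B-basis)))

  contraction-determines-covering-Basis : (∀ X → ConBasis M T X → ConBasis M′ T X) →
                                          ∀ {B} → Basis M B → T ⊆ B → Basis M′ B
  contraction-determines-covering-Basis con {B} B-basis T⊆B
    with con (B ─ T) (T⊆Basis⇒ConBasis B-basis T⊆B)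
  ... | _ , I′ , (I′⊆T , _ , _) , B′-basis = subst (Basis M′)
          (p⊆q∧∣q∣≤∣p∣⇒p≡q (∪-lub (p─q⊆p B T) (⊆-trans I′⊆T T⊆B))
                           (≤-reflexive (trans (rank B B-basis) (sym (rank′ _ B′-basis)))))
          B′-basis

module SwapPair {e f : Fin n} (e≢f : e ≢ f) (M M′ : Matroid n) {r : ℕ}
  (rank : HasRank M r) (rank′ : HasRank M′ r)
  (aut : IsAutomorphism M (transpose e f)) (aut′ : IsAutomorphism M′ (transpose e f))
  (del  : ∀ X → DelBasis M  (⁅ e ⁆ ∪ ⁅ f ⁆) X → DelBasis M′ (⁅ e ⁆ ∪ ⁅ f ⁆) X)
  (del⁻ : ∀ X → DelBasis M′ (⁅ e ⁆ ∪ ⁅ f ⁆) X → DelBasis M  (⁅ e ⁆ ∪ ⁅ f ⁆) X)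
  (con  : ∀ X → ConBasis M  (⁅ e ⁆ ∪ ⁅ f ⁆) X → ConBasis M′ (⁅ e ⁆ ∪ ⁅ f ⁆) X) where

  S : Subset n
  S = ⁅ e ⁆ ∪ ⁅ f ⁆

  module R  = RankLemmas M rank
  module R′ = RankLemmas M′ rank′
  module Δ  = Minors M M′ rank rank′ S
  module Δ⁻ = Minors M′ M rank′ rank S

  e∈S : e ∈ S
  e∈S = p⊆p∪q ⁅ f ⁆ (x∈⁅x⁆ e)

  f∈S : f ∈ S
  f∈S = q⊆p∪q ⁅ e ⁆ ⁅ f ⁆ (x∈⁅x⁆ f)

  x∈S⁻ : x ∈ S → x ≡ e ⊎ x ≡ f
  x∈S⁻ x∈S with x∈p∪q⁻ ⁅ e ⁆ ⁅ f ⁆ x∈S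
  ... | inj₁ x∈⁅e⁆ = inj₁ (x∈⁅y⁆⇒x≡y e x∈⁅e⁆)
  ... | inj₂ x∈⁅f⁆ = inj₂ (x∈⁅y⁆⇒x≡y f x∈⁅f⁆)

  S⊆ : e ∈ p → f ∈ p → S ⊆ p
  S⊆ e∈p f∈p = ∪-lub (x∈p⇒⁅x⁆⊆p e∈p) (x∈p⇒⁅x⁆⊆p f∈p)

  ⊆∁S : e ∉ p → f ∉ p → p ⊆ ∁ S
  ⊆∁S {p = p} e∉p f∉p {x} x∈p = x∉p⇒x∈∁p x∉S
    where
    x∉S : x ∉ S
    x∉S x∈S with x∈S⁻ x∈S
    ... | inj₁ x≡e = e∉p (subst (_∈ p) x≡e x∈p)
    ... | inj₂ x≡f = f∉p (subst (_∈ p) x≡f x∈p)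

  Completion : Subset n → Set
  Completion X = ∃ λ t → t ∈ S × Basis M′ (X ∪ ⁅ t ⁆)

  module _ {X : Subset n} (X⊆∁S : X ⊆ ∁ S) (1+∣X∣≡r : suc ∣ X ∣ ≡ r)
           (B-basis : Basis M (X ∪ ⁅ e ⁆)) where

    ∣X∣<r : ∣ X ∣ < r
    ∣X∣<r = ≤-reflexive 1+∣X∣≡r

    x∈S⇒x∉X : x ∈ S → x ∉ X
    x∈S⇒x∉X x∈S x∈X = x∈∁p⇒x∉p (X⊆∁S x∈X) x∈S

    x∈XeS⇒x∈S : x ∈ (X ∪ ⁅ e ⁆) ∪ S → x ∉ X → x ∈ S
    x∈XeS⇒x∈S x∈XeS x∉X with x∈p∪q⁻ (X ∪ ⁅ e ⁆) S x∈XeS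
    ... | inj₂ x∈S = x∈S
    ... | inj₁ x∈Xe with x∈p∪⁅y⁆⁻ X e x∈Xe
    ...   | inj₁ x∈X = contradiction x∈X x∉X
    ...   | inj₂ x≡e = subst (_∈ S) (sym x≡e) e∈S

    Completion⇒Basis : Completion X → Basis M′ (X ∪ ⁅ e ⁆)
    Completion⇒Basis (t , t∈S , Xt-basis) with x∈S⁻ t∈S
    ... | inj₁ t≡e = subst (λ t → Basis M′ (X ∪ ⁅ t ⁆)) t≡e Xt-basis
    ... | inj₂ t≡f = subst (Basis M′) (image-transpose e≢f (x∈S⇒x∉X e∈S) (x∈S⇒x∉X f∈S))
                       (subst T (aut′ (X ∪ ⁅ f ⁆)) (subst (λ t → Basis M′ (X ∪ ⁅ t ⁆)) t≡f Xt-basis))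

    -- If S is dependent in M, then ⁅ e ⁆ is a basis of M|S and X a basis of M / S.
    via-contraction : ¬ Indep M S → Completion X
    via-contraction S-dependent with con X (X⊆∁S , ⁅ e ⁆ , e-maximal , B-basis)
      where
      maximal : ∀ Y → ⁅ e ⁆ ⊆ Y → Y ⊆ S → Indep M Y → Y ⊆ ⁅ e ⁆
      maximal Y e⊆Y Y⊆S (C , C-basis , Y⊆C) {y} y∈Y with x∈S⁻ (Y⊆S y∈Y)
      ... | inj₁ y≡e = subst (_∈ ⁅ e ⁆) (sym y≡e) (x∈⁅x⁆ e)
      ... | inj₂ y≡f = ⊥-elim (S-dependent
              (C , C-basis , S⊆ (Y⊆C (e⊆Y (x∈⁅x⁆ e))) (Y⊆C (subst (_∈ Y) y≡f y∈Y))))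
      e-maximal : MaxIndepIn M S ⁅ e ⁆
      e-maximal = x∈p⇒⁅x⁆⊆p e∈S , (X ∪ ⁅ e ⁆ , B-basis , q⊆p∪q X ⁅ e ⁆) , maximal
    ... | _ , I′ , (I′⊆S , _ , _) , XI′-basis with R′.Basis⊈small XI′-basis ∣X∣<r
    ...   | t , t∈XI′ , t∉X = t , t∈S , R′.X∪⁅x⁆-Basis XI′-basis (p⊆p∪q I′) t∈XI′ t∉X 1+∣X∣≡r
      where
      t∈S : t ∈ S
      t∈S with x∈p∪q⁻ X I′ t∈XI′
      ... | inj₁ t∈X = contradiction t∈X t∉X
      ... | inj₂ t∈I′ = I′⊆S t∈I′

    -- Without a basis of M between X and ∁ S, X is a basis of M \ S.
    via-deletion : ¬ (∃ λ C → Basis M C × X ⊆ C × C ⊆ ∁ S) → Completion X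
    via-deletion no-basis with del X (X⊆∁S , (X ∪ ⁅ e ⁆ , B-basis , p⊆p∪q ⁅ e ⁆) , maximal)
      where
      maximal : ∀ Y → X ⊆ Y → Y ⊆ ∁ S → Indep M Y → Y ⊆ X
      maximal Y X⊆Y Y⊆∁S (C , C-basis , Y⊆C) {y} y∈Y with y ∈? X
      ... | yes y∈X = y∈X
      ... | no  y∉X = ⊥-elim (no-basis (C , C-basis , X⊆C ,
              R.Basis⊆ C-basis X⊆C (Y⊆C y∈Y) y∉X 1+∣X∣≡r X⊆∁S (Y⊆∁S y∈Y)))
        where
        X⊆C : X ⊆ C
        X⊆C = ⊆-trans X⊆Y Y⊆C
    ... | _ , (C′ , C′-basis , X⊆C′) , _ with R′.Basis⊈small C′-basis ∣X∣<r
    ...   | t , t∈C′ , t∉X with t ∈? S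
    ...     | yes t∈S = t , t∈S , R′.X∪⁅x⁆-Basis C′-basis X⊆C′ t∈C′ t∉X 1+∣X∣≡r
    ...     | no  t∉S = ⊥-elim (no-basis
              (C′ , Δ⁻.deletion-determines-disjoint-Basis del⁻ C′-basis C′⊆∁S , X⊆C′ , C′⊆∁S))
      where
      C′⊆∁S : C′ ⊆ ∁ S
      C′⊆∁S = R′.Basis⊆ C′-basis X⊆C′ t∈C′ t∉X 1+∣X∣≡r X⊆∁S (x∉p⇒x∈∁p t∉S)

    -- A basis X ∪ ⁅ g ⁆ ⊆ ∁ S and a basis D ⊇ S inside X ∪ S are shared by M and M′,
    -- and exchanging g for an element of D lands in S.
    via-exchange : Indep M S → ∀ {C} → Basis M C → X ⊆ C → C ⊆ ∁ S → Completion X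
    via-exchange S-indep {C} C-basis X⊆C C⊆∁S
      with Indep⇒Basis-within M S-indep B-basis | R.Basis⊈small C-basis ∣X∣<r
    ... | D , D-basis , S⊆D , D⊆XeS | g , g∈C , g∉X
      with exchange M′ C D (Δ.deletion-determines-disjoint-Basis del C-basis C⊆∁S)
             (Δ.contraction-determines-covering-Basis con D-basis S⊆D) g g∈C g∉D
      where
      g∉D : g ∉ D
      g∉D g∈D = x∈∁p⇒x∉p (C⊆∁S g∈C) (x∈XeS⇒x∈S (D⊆XeS g∈D) g∉X)
    ... | y , y∈D , y∉C , C′-basis =
          y , x∈XeS⇒x∈S (D⊆XeS y∈D) (y∉C ∘ X⊆C) ,
          R′.X∪⁅x⁆-Basis C′-basis X⊆C′ (q⊆p∪q (C - g) ⁅ y ⁆ (x∈⁅x⁆ y)) (y∉C ∘ X⊆C) 1+∣X∣≡r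
      where
      X⊆C′ : X ⊆ (C - g) ∪ ⁅ y ⁆
      X⊆C′ x∈X = p⊆p∪q ⁅ y ⁆ (x∈p∧x≢y⇒x∈p-y (X⊆C x∈X) λ { refl → g∉X x∈X })

    X∪⁅e⁆-Basis′ : Basis M′ (X ∪ ⁅ e ⁆)
    X∪⁅e⁆-Basis′ = Completion⇒Basis completion
      where
      completion : Completion X
      completion with anySubset? (λ C → T? (isBasis M C) ×-dec (S ⊆? C))
      ... | no S-dependent = via-contraction S-dependent
      ... | yes S-indep with anySubset? (λ C → T? (isBasis M C) ×-dec ((X ⊆? C) ×-dec (C ⊆? ∁ S)))
      ...   | no  no-basis = via-deletion no-basis
      ...   | yes (C , C-basis , X⊆C , C⊆∁S) = via-exchange S-indep C-basis X⊆C C⊆∁S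

  one-sided-transfer : ∀ {B} → Basis M B → e ∈ B → f ∉ B → Basis M′ B
  one-sided-transfer {B} B-basis e∈B f∉B =
    subst (Basis M′) X∪⁅e⁆≡B (X∪⁅e⁆-Basis′ X⊆∁S 1+∣X∣≡r (subst (Basis M) (sym X∪⁅e⁆≡B) B-basis))
    where
    X : Subset n
    X = B - e
    X∪⁅e⁆≡B : X ∪ ⁅ e ⁆ ≡ B
    X∪⁅e⁆≡B = q⊆p⇒p─q∪q≡p (x∈p⇒⁅x⁆⊆p e∈B)
    X⊆∁S : X ⊆ ∁ S
    X⊆∁S = ⊆∁S (λ e∈X → x∈p─q⇒x∉q B ⁅ e ⁆ e∈X (x∈⁅x⁆ e)) (f∉B ∘ p─q⊆p B ⁅ e ⁆)
    1+∣X∣≡r : suc ∣ X ∣ ≡ r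
    1+∣X∣≡r = trans (sym (∣p∣≡1+∣p-x∣ B e∈B)) (rank B B-basis)

  transfer : ∀ {B} → Basis M B → Basis M′ B
  transfer {B} B-basis with e ∈? B | f ∈? B
  ... | yes e∈B | yes f∈B = Δ.contraction-determines-covering-Basis con B-basis (S⊆ e∈B f∈B)
  ... | no  e∉B | no  f∉B = Δ.deletion-determines-disjoint-Basis del B-basis (⊆∁S e∉B f∉B)
  ... | yes e∈B | no  f∉B = one-sided-transfer B-basis e∈B f∉B
  ... | no  e∉B | yes f∈B =
        subst T (sym (aut′ B)) (one-sided-transfer (subst T (aut B) B-basis) e∈πB f∉πB)
    where
    e∈πB : e ∈ image (transpose e f) B
    e∈πB = ∈-image⁺ (transpose e f) B (subst (_∈ B) (sym (transposeˡ-e e≢f)) f∈B)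
    f∉πB : f ∉ image (transpose e f) B
    f∉πB f∈πB = e∉B (subst (_∈ B) (transposeˡ-f {e = e} {f = f}) (∈-image⁻ (transpose e f) B f∈πB))

lemma4p3 : (n : ℕ) → n ≥ 2 → (e f : Fin n) → ¬ (e ≡ f) →
    (M M′ : Matroid n) (r : ℕ) → HasRank M r → HasRank M′ r →
    IsAutomorphism M (transpose e f) → IsAutomorphism M′ (transpose e f) →
    (∀ X → DelBasis M (⁅ e ⁆ ∪ ⁅ f ⁆) X ⇔ DelBasis M′ (⁅ e ⁆ ∪ ⁅ f ⁆) X) →
    (∀ X → ConBasis M (⁅ e ⁆ ∪ ⁅ f ⁆) X ⇔ ConBasis M′ (⁅ e ⁆ ∪ ⁅ f ⁆) X) →
    ∀ X → isBasis M X ≡ isBasis M′ X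
lemma4p3 n _ e f e≢f M M′ r rank rank′ aut aut′ del con X =
  T⇔T⇒≡ (isBasis M X) (isBasis M′ X)
    (SwapPair.transfer e≢f M M′ rank rank′ aut aut′ del⇒ del⇐ con⇒)
    (SwapPair.transfer e≢f M′ M rank′ rank aut′ aut del⇐ del⇒ con⇐)
  where
  del⇒ = λ Y → Equivalence.to   (del Y)
  del⇐ = λ Y → Equivalence.from (del Y)
  con⇒ = λ Y → Equivalence.to   (con Y)
  con⇐ = λ Y → Equivalence.from (con Y)
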